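{- Let $n\ge 2$ and let $G$ be the graph obtained from $K_n$ by replacing each edge $uv$ with two internally disjoint paths $u\text{ -- }x\text{ -- }v$ and $u\text{ -- }y\text{ -- }z\text{ -- }v$, where $x,y,z$ are new vertices (distinct for each edge). Then $\operatorname{fdom}(G)=5/2$, and if $\phi$ is a dominating $(5k:2k)$-colouring of $G$ for some integer $k\ge 1$, then $k\ge n/5$.
   Context: For integers $0<q\le p$, a dominating $(p:q)$-colouring of a graph $G$ is a map $\phi\colon V(G)\to\binom{[p]}{q}$ with $\bigcup_{u\in N[v]}\phi(u)=[p]$ for every vertex $v$ ($N[v]$ the closed neighbourhood); $\operatorname{fdom}(G)$ is the maximum of $p/q$ over such colourings. -}

module Defs where

open import Data.Nat using (ℕ; _≤_; _*_; _<_)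
open import Data.Fin using (Fin)
import Data.Fin as F
open import Data.Fin.Subset using (Subset; _∈_; ∣_∣)
open import Data.Product using (Σ; ∃; _×_)
open import Data.Sum using (_⊎_)
open import Relation.Binary.PropositionalEquality using (_≡_)

record Graph : Set₁ where
  field
    Vtx : Set
    Adj : Vtx → Vtx → Set

open Graph public

InClosedNbhd : (G : Graph) → Vtx G → Vtx G → Set
InClosedNbhd G u v = (u ≡ v) ⊎ Adj G v u

record DomColouring (G : Graph) (p q : ℕ) : Set where
  field
    φ     : Vtx G → Subset p
    size  : ∀ v → ∣ φ v ∣ ≡ q
    cover : ∀ v (c : Fin p) → Σ (Vtx G) (λ u → InClosedNbhd G u v × c ∈ φ u)

-- fdom(G) = a/b  (a, b > 0): the maximum of p/q over dominating (p:q)-colourings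
-- with 0 < q ≤ p is attained and equals a/b.  (q ≤ p is automatic for a q-subset of [p].)
FdomEq : Graph → ℕ → ℕ → Set
FdomEq G a b =
  (Σ ℕ λ p → Σ ℕ λ q → (1 ≤ q) × DomColouring G p q × (p * b ≡ a * q))
  × (∀ p q → 1 ≤ q → DomColouring G p q → p * b ≤ a * q)

-- The construction: vertices of K_n, plus for every edge {i,j} (i < j) new vertices x, y, z
-- with paths i – x – j and i – y – z – j.
data Tag : Set where
  tx ty tz : Tag

data V (n : ℕ) : Set where
  orig : Fin n → V n
  sub  : (i j : Fin n) → .(F._<_ i j) → Tag → V n

data E {n : ℕ} : V n → V n → Set where
  e-ix : ∀ {i j} .(p : F._<_ i j) → E (orig i) (sub i j p tx)
  e-xj : ∀ {i j} .(p : F._<_ i j) → E (sub i j p tx) (orig j)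
  e-iy : ∀ {i j} .(p : F._<_ i j) → E (orig i) (sub i j p ty)
  e-yz : ∀ {i j} .(p : F._<_ i j) → E (sub i j p ty) (sub i j p tz)
  e-zj : ∀ {i j} .(p : F._<_ i j) → E (sub i j p tz) (orig j)

G36 : ℕ → Graph
G36 n = record { Vtx = V n ; Adj = λ u v → E u v ⊎ E v u }

{-# OPTIONS --safe #-}
module Submission where

-- Let x and y, z be the inner vertices of the paths i–x–j and i–y–z–j that replace an edge ij,
-- and φ a dominating (p:q)-colouring. A colour missing from y and z lies, by domination of y and
-- of z, on both i and j; a colour missing from i and j lies on x. Counting colours gives
-- p ≤ 2q + |φ(i) ∩ φ(j)| and p + |φ(i) ∩ φ(j)| ≤ 3q, hence 2p ≤ 5q, and for (p, q) = (5k, 2k)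
-- both are tight: |φ(i) ∩ φ(j)| = k whenever i ≠ j.
--
-- The indicator vectors of the n sets φ(i) ⊆ [5k] then have the nonsingular Gram matrix
-- k(I + J), so n ≤ 5k. Instead of rank this uses the orthogonal projection onto their span: each
-- of its 5k diagonal entries is at most 1 by Cauchy–Schwarz, and together they sum to n.
--
-- Conversely, for k = 2^(n-2) the coordinate half-cubes {c ∈ {0,1}^n : c_i = 1} are n sets of
-- size 2k in a 4k-set meeting pairwise in k elements. Giving the half-cube of i to i, the cell
-- outside those of i and j to x, the cell in j's but not i's to y, the complement of j's to z,
-- and k further colours to every x and y yields a dominating (5k:2k)-colouring.

open import Defs
open import Data.Bool.Base using (true; false; _∧_; if_then_else_)
open import Data.Empty using (⊥-elim)
open import Data.Fin.Base as Fin using (Fin; zero; suc; punchIn; splitAt; _↑ˡ_; _↑ʳ_)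
open import Data.Fin.Properties as FinP using (_≟_; <-cmp; join-splitAt)
open import Data.Fin.Subset using (Subset; _∈_; _⊆_; ∣_∣; _∩_; _∪_; ∁; ⊤; ⊥)
open import Data.Fin.Subset.Properties
  using (_∈?_; ∈⊤; ∣⊤∣≡n; ∣⊥∣≡0; ∣p∣≤n; ∣∁p∣≡n∸∣p∣; p⊆q⇒∣p∣≤∣q∣; x∈p∪q⁺; x∈p∩q⁺; x∉p⇒x∈∁p;
         ∩-comm; ∩-idem; ∩-zeroˡ; ∩-identityˡ)
import Data.Nat.Base as ℕ
open import Data.Nat.Base using (ℕ; zero; suc; z≤n; s≤s; z<s)
open import Data.Product using (Σ; _×_; _,_)
open import Data.Sum using (inj₁; inj₂)
open import Data.Vec.Base using ([]; _∷_; _++_; lookup; here; there)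
open import Data.Vec.Properties using (lookup-zipWith; zipWith-++)
open import Function using (_∘_)
open import Relation.Binary.Definitions using (tri<; tri≈; tri>)
open import Relation.Binary.PropositionalEquality
open import Relation.Nullary using (yes; no)
open import Relation.Nullary.Decidable using (recompute)

module FisherInequality where

  open import Data.Integer.Base
    using (ℤ; +_; -[1+_]; 0ℤ; 1ℤ; _+_; _-_; -_; _*_; _≤_; _<_; +≤+; +<+; positive; nonNegative)
  import Data.Integer.Properties as ℤP
  open import Algebra.Properties.Semiring.Sum ℤP.+-*-semiring
  open import Data.Integer.Tactic.RingSolver using (solve-∀)
  open import Data.Vec.Functional using (removeAt)

  ⟨_,_⟩ : ∀ {m} → (Fin m → ℤ) → (Fin m → ℤ) → ℤ
  ⟨_,_⟩ {m} u v = ∑[ c < m ] (u c * v c)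

  δ : ∀ {n} → Fin n → Fin n → ℤ
  δ zero    zero    = 1ℤ
  δ zero    (suc j) = 0ℤ
  δ (suc i) zero    = 0ℤ
  δ (suc i) (suc j) = δ i j

  δ-diag : ∀ {n} (i : Fin n) → δ i i ≡ 1ℤ
  δ-diag zero    = refl
  δ-diag (suc i) = δ-diag i

  δ-offdiag : ∀ {n} {i j : Fin n} → i ≢ j → δ i j ≡ 0ℤ
  δ-offdiag {i = zero}  {zero}  i≢j = ⊥-elim (i≢j refl)
  δ-offdiag {i = zero}  {suc j} _   = refl
  δ-offdiag {i = suc i} {zero}  _   = refl
  δ-offdiag {i = suc i} {suc j} i≢j = δ-offdiag (i≢j ∘ cong suc)

  δ-sift : ∀ {n} (i : Fin n) (y : Fin n → ℤ) → ∑[ j < n ] (δ i j * y j) ≡ y i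
  δ-sift {suc n} zero y = begin
    1ℤ * y zero + ∑[ j < n ] 0ℤ    ≡⟨ cong₂ _+_ (ℤP.*-identityˡ (y zero)) (sum-replicate-zero n) ⟩
    y zero + 0ℤ                    ≡⟨ ℤP.+-identityʳ (y zero) ⟩
    y zero                         ∎
    where open ≡-Reasoning
  δ-sift {suc n} (suc i) y = trans (ℤP.+-identityˡ _) (δ-sift i (y ∘ suc))

  ∑-const : ∀ n x → ∑[ i < n ] x ≡ + n * x
  ∑-const zero    x = refl
  ∑-const (suc n) x = trans (cong (_+_ x) (∑-const n x)) (sym (ℤP.suc-* (+ n) x))

  ∑-linear : ∀ {n} u v (f g : Fin n → ℤ) → ∑[ i < n ] (u * f i + v * g i) ≡ u * sum f + v * sum g
  ∑-linear u v f g = trans (∑-distrib-+ (λ i → u * f i) (λ i → v * g i))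
                           (sym (cong₂ _+_ (*-distribˡ-sum u f) (*-distribˡ-sum v g)))

  sum-mono-≤ : ∀ {n} {x y : Fin n → ℤ} → (∀ i → x i ≤ y i) → sum x ≤ sum y
  sum-mono-≤ {zero}  _   = ℤP.≤-refl
  sum-mono-≤ {suc n} x≤y = ℤP.+-mono-≤ (x≤y zero) (sum-mono-≤ (x≤y ∘ suc))

  ≤-sum : ∀ {n} (x : Fin n → ℤ) → (∀ i → 0ℤ ≤ x i) → ∀ i → x i ≤ sum x
  ≤-sum {suc n} x 0≤x i = begin
    x i                          ≡⟨ ℤP.+-identityʳ (x i) ⟨
    x i + 0ℤ                     ≡⟨ cong (_+_ (x i)) (sum-replicate-zero n) ⟨
    x i + ∑[ j < n ] 0ℤ          ≤⟨ ℤP.+-monoʳ-≤ (x i) (sum-mono-≤ (0≤x ∘ punchIn i)) ⟩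
    x i + sum (removeAt x i)     ≡⟨ sum-remove x ⟨
    sum x                        ∎
    where open ℤP.≤-Reasoning

  0≤i*i : ∀ i → 0ℤ ≤ i * i
  0≤i*i (+ n)    = subst (0ℤ ≤_) (ℤP.pos-* n n) (+≤+ z≤n)
  0≤i*i -[1+ n ] = +≤+ z≤n

  i*i≤j*i⇒i≤j : ∀ {i j} → 0ℤ ≤ j → i * i ≤ j * i → i ≤ j
  i*i≤j*i⇒i≤j {i} {j} 0≤j i*i≤j*i with i ℤP.≤? 0ℤ
  ... | yes i≤0 = ℤP.≤-trans i≤0 0≤j
  ... | no  i≰0 = ℤP.*-cancelʳ-≤-pos i j i {{positive (ℤP.≰⇒> i≰0)}} i*i≤j*i

  module _ {n m : ℕ} (A : Fin n → Fin m → ℤ) where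

    Aᵀ : (Fin n → ℤ) → Fin m → ℤ
    Aᵀ y c = ∑[ i < n ] (y i * A i c)

    ⟨Aᵀy,Aᵀy⟩≡yᵀGy : ∀ y → ⟨ Aᵀ y , Aᵀ y ⟩ ≡ ∑[ i < n ] ∑[ j < n ] (y i * y j * ⟨ A i , A j ⟩)
    ⟨Aᵀy,Aᵀy⟩≡yᵀGy y = begin
      ∑[ c < m ] (Aᵀ y c * Aᵀ y c)
        ≡⟨ sum-cong-≗ (λ c → *-distribʳ-sum (Aᵀ y c) (λ i → y i * A i c)) ⟩
      ∑[ c < m ] ∑[ i < n ] (y i * A i c * Aᵀ y c)
        ≡⟨ sum-cong-≗ (λ c → sum-cong-≗ (λ i → *-distribˡ-sum (y i * A i c) (λ j → y j * A j c))) ⟩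
      ∑[ c < m ] ∑[ i < n ] ∑[ j < n ] (y i * A i c * (y j * A j c))
        ≡⟨ ∑-comm (λ c i → ∑[ j < n ] (y i * A i c * (y j * A j c))) ⟩
      ∑[ i < n ] ∑[ c < m ] ∑[ j < n ] (y i * A i c * (y j * A j c))
        ≡⟨ sum-cong-≗ (λ i → ∑-comm (λ c j → y i * A i c * (y j * A j c))) ⟩
      ∑[ i < n ] ∑[ j < n ] ∑[ c < m ] (y i * A i c * (y j * A j c))
        ≡⟨ sum-cong-≗ (λ i → sum-cong-≗ (pull-out i)) ⟩
      ∑[ i < n ] ∑[ j < n ] (y i * y j * ⟨ A i , A j ⟩)  ∎
      where
      open ≡-Reasoning
      interchange : ∀ a b c d → a * b * (c * d) ≡ a * c * (b * d)
      interchange = solve-∀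
      pull-out : ∀ i j → ∑[ c < m ] (y i * A i c * (y j * A j c)) ≡ y i * y j * ⟨ A i , A j ⟩
      pull-out i j = trans (sum-cong-≗ (λ c → interchange (y i) (A i c) (y j) (A j c)))
                           (sym (*-distribˡ-sum (y i * y j) (λ c → A i c * A j c)))

  module GramBound {n m : ℕ} (κ μ : ℕ) (0<κ : 0 ℕ.< κ) (A : Fin n → Fin m → ℤ)
                   (gram : ∀ i j → ⟨ A i , A j ⟩ ≡ + μ + + κ * δ i j) where

    K M N L : ℤ
    K = + κ
    M = + μ
    N = K + + n * M
    L = K * N

    ⟨Aᵀy,Aᵀy⟩≡yᵀ[MJ+KI]y : ∀ y → ⟨ Aᵀ A y , Aᵀ A y ⟩ ≡ M * (sum y * sum y) + K * ⟨ y , y ⟩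
    ⟨Aᵀy,Aᵀy⟩≡yᵀ[MJ+KI]y y = begin
      ⟨ Aᵀ A y , Aᵀ A y ⟩
        ≡⟨ ⟨Aᵀy,Aᵀy⟩≡yᵀGy A y ⟩
      ∑[ i < n ] ∑[ j < n ] (y i * y j * ⟨ A i , A j ⟩)
        ≡⟨ sum-cong-≗ row ⟩
      ∑[ i < n ] ((M * sum y) * y i + K * (y i * y i))
        ≡⟨ ∑-linear (M * sum y) K y (λ i → y i * y i) ⟩
      (M * sum y) * sum y + K * ⟨ y , y ⟩
        ≡⟨ cong (_+ K * ⟨ y , y ⟩) (ℤP.*-assoc M (sum y) (sum y)) ⟩
      M * (sum y * sum y) + K * ⟨ y , y ⟩  ∎
      where
      open ≡-Reasoning
      row : ∀ i → ∑[ j < n ] (y i * y j * ⟨ A i , A j ⟩) ≡ (M * sum y) * y i + K * (y i * y i)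
      row i = begin
        ∑[ j < n ] (y i * y j * ⟨ A i , A j ⟩)
          ≡⟨ sum-cong-≗ (λ j → trans (cong (y i * y j *_) (gram i j)) (expand (y i) (y j) (δ i j) M K)) ⟩
        ∑[ j < n ] ((y i * M) * y j + (y i * K) * (δ i j * y j))
          ≡⟨ ∑-linear (y i * M) (y i * K) y (λ j → δ i j * y j) ⟩
        (y i * M) * sum y + (y i * K) * ∑[ j < n ] (δ i j * y j)
          ≡⟨ cong (λ z → (y i * M) * sum y + (y i * K) * z) (δ-sift i y) ⟩
        (y i * M) * sum y + (y i * K) * y i
          ≡⟨ regroup (y i) (sum y) M K ⟩
        (M * sum y) * y i + K * (y i * y i)  ∎
        where
        expand : ∀ a b d M K → a * b * (M + K * d) ≡ (a * M) * b + (a * K) * (d * b)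
        expand = solve-∀
        regroup : ∀ a s M K → (a * M) * s + (a * K) * a ≡ (M * s) * a + K * (a * a)
        regroup = solve-∀

    0<L : 0ℤ < L
    0<L = ℤP.*-monoʳ-<-pos N {{positive 0<N}} 0<K
      where
      0<K : 0ℤ < K
      0<K = +<+ 0<κ
      0≤nM : 0ℤ ≤ + n * M
      0≤nM = subst (0ℤ ≤_) (ℤP.pos-* n μ) (+≤+ z≤n)
      0<N : 0ℤ < N
      0<N = ℤP.<-≤-trans 0<K (ℤP.i≤i+j K (+ n * M) {{nonNegative 0≤nM}})

    -- For the column a of A at c, y = L (MJ + KI)⁻¹ a because (MJ + KI)⁻¹ = (I − MJ / N) / K;
    -- so t = aᵀ y is L times the c-th diagonal entry of the orthogonal projection onto the
    -- row space of A.
    module Column (c : Fin m) where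

      a : Fin n → ℤ
      a i = A i c

      s r t : ℤ
      s = sum a
      r = ⟨ a , a ⟩
      t = N * r - M * (s * s)

      y : Fin n → ℤ
      y i = N * a i - M * s

      ∑-quadratic : ∀ u v w → ∑[ i < n ] (u * (a i * a i) + v * a i + w) ≡ u * r + v * s + + n * w
      ∑-quadratic u v w = trans (∑-distrib-+ (λ i → u * (a i * a i) + v * a i) (λ _ → w))
                                (cong₂ _+_ (∑-linear u v (λ i → a i * a i) a) (∑-const n w))

      Aᵀy≡t : Aᵀ A y c ≡ t
      Aᵀy≡t = begin
        ∑[ i < n ] (y i * a i)
          ≡⟨ sum-cong-≗ (λ i → expand (a i) N M s) ⟩
        ∑[ i < n ] (N * (a i * a i) + - (M * s) * a i + 0ℤ)
          ≡⟨ ∑-quadratic N (- (M * s)) 0ℤ ⟩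
        N * r + - (M * s) * s + + n * 0ℤ
          ≡⟨ simplify N M r s (+ n) ⟩
        t  ∎
        where
        open ≡-Reasoning
        expand : ∀ a N M s → (N * a - M * s) * a ≡ N * (a * a) + - (M * s) * a + 0ℤ
        expand = solve-∀
        simplify : ∀ N M r s n → N * r + - (M * s) * s + n * 0ℤ ≡ N * r - M * (s * s)
        simplify = solve-∀

      ∑y≡Ks : sum y ≡ K * s
      ∑y≡Ks = begin
        ∑[ i < n ] y i
          ≡⟨ sum-cong-≗ (λ i → expand (a i) N M s) ⟩
        ∑[ i < n ] (0ℤ * (a i * a i) + N * a i + - (M * s))
          ≡⟨ ∑-quadratic 0ℤ N (- (M * s)) ⟩
        0ℤ * r + N * s + + n * - (M * s)
          ≡⟨ simplify K M r s (+ n) ⟩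
        K * s  ∎
        where
        open ≡-Reasoning
        expand : ∀ a N M s → N * a - M * s ≡ 0ℤ * (a * a) + N * a + - (M * s)
        expand = solve-∀
        simplify : ∀ K M r s n → 0ℤ * r + (K + n * M) * s + n * - (M * s) ≡ K * s
        simplify = solve-∀

      ⟨y,y⟩-expand : ⟨ y , y ⟩ ≡ N * N * r + - (+ 2 * N * M * s) * s + + n * (M * s * (M * s))
      ⟨y,y⟩-expand = trans (sum-cong-≗ (λ i → expand (a i) N M s))
                    (∑-quadratic (N * N) (- (+ 2 * N * M * s)) (M * s * (M * s)))
        where
        expand : ∀ a N M s → (N * a - M * s) * (N * a - M * s)
                             ≡ N * N * (a * a) + - (+ 2 * N * M * s) * a + M * s * (M * s)
        expand = solve-∀

      ⟨Aᵀy,Aᵀy⟩≡Lt : ⟨ Aᵀ A y , Aᵀ A y ⟩ ≡ L * t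
      ⟨Aᵀy,Aᵀy⟩≡Lt = begin
        ⟨ Aᵀ A y , Aᵀ A y ⟩
          ≡⟨ ⟨Aᵀy,Aᵀy⟩≡yᵀ[MJ+KI]y y ⟩
        M * (sum y * sum y) + K * ⟨ y , y ⟩
          ≡⟨ cong₂ (λ σ q → M * (σ * σ) + K * q) ∑y≡Ks ⟨y,y⟩-expand ⟩
        M * (K * s * (K * s)) + K * (N * N * r + - (+ 2 * N * M * s) * s + + n * (M * s * (M * s)))
          ≡⟨ simplify K M r s (+ n) ⟩
        L * t  ∎
        where
        open ≡-Reasoning
        simplify : ∀ K M r s n →
          let N = K + n * M in
          M * (K * s * (K * s)) + K * (N * N * r + - (+ 2 * N * M * s) * s + n * (M * s * (M * s)))
            ≡ K * N * (N * r - M * (s * s))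
        simplify = solve-∀

      t≤L : t ≤ L
      t≤L = i*i≤j*i⇒i≤j (ℤP.<⇒≤ 0<L) (begin
        t * t                       ≡⟨ cong (λ τ → τ * τ) Aᵀy≡t ⟨
        Aᵀ A y c * Aᵀ A y c         ≤⟨ ≤-sum (λ d → Aᵀ A y d * Aᵀ A y d) (λ d → 0≤i*i (Aᵀ A y d)) c ⟩
        ⟨ Aᵀ A y , Aᵀ A y ⟩         ≡⟨ ⟨Aᵀy,Aᵀy⟩≡Lt ⟩
        L * t                       ∎)
        where open ℤP.≤-Reasoning

    open Column using (r; s; t; t≤L)

    ∑t≡nL : ∑[ c < m ] t c ≡ + n * L
    ∑t≡nL = begin
      ∑[ c < m ] t c
        ≡⟨ sum-cong-≗ (λ c → cong (_+_ (N * r c)) (ℤP.neg-distribˡ-* M (s c * s c))) ⟩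
      ∑[ c < m ] (N * r c + - M * (s c * s c))
        ≡⟨ ∑-linear N (- M) r (λ c → s c * s c) ⟩
      N * (∑[ c < m ] r c) + - M * (∑[ c < m ] (s c * s c))
        ≡⟨ cong₂ (λ ρ σ → N * ρ + - M * σ) ∑r ∑s² ⟩
      N * (+ n * (M + K * 1ℤ)) + - M * (M * (+ n * 1ℤ * (+ n * 1ℤ)) + K * (+ n * (1ℤ * 1ℤ)))
        ≡⟨ simplify K M (+ n) ⟩
      + n * L  ∎
      where
      open ≡-Reasoning
      ∑r : ∑[ c < m ] r c ≡ + n * (M + K * 1ℤ)
      ∑r = begin
        ∑[ c < m ] ∑[ i < n ] (A i c * A i c)
          ≡⟨ ∑-comm (λ c i → A i c * A i c) ⟩
        ∑[ i < n ] ⟨ A i , A i ⟩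
          ≡⟨ sum-cong-≗ (λ i → trans (gram i i) (cong (λ d → M + K * d) (δ-diag i))) ⟩
        ∑[ i < n ] (M + K * 1ℤ)
          ≡⟨ ∑-const n _ ⟩
        + n * (M + K * 1ℤ)  ∎
      𝟏 : Fin n → ℤ
      𝟏 _ = 1ℤ
      ∑s² : ∑[ c < m ] (s c * s c) ≡ M * (+ n * 1ℤ * (+ n * 1ℤ)) + K * (+ n * (1ℤ * 1ℤ))
      ∑s² = begin
        ∑[ c < m ] (s c * s c)
          ≡⟨ sum-cong-≗ (λ c → cong (λ σ → σ * σ) (sum-cong-≗ (λ i → sym (ℤP.*-identityˡ (A i c))))) ⟩
        ⟨ Aᵀ A 𝟏 , Aᵀ A 𝟏 ⟩
          ≡⟨ ⟨Aᵀy,Aᵀy⟩≡yᵀ[MJ+KI]y 𝟏 ⟩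
        M * (sum 𝟏 * sum 𝟏) + K * ⟨ 𝟏 , 𝟏 ⟩
          ≡⟨ cong₂ (λ σ q → M * (σ * σ) + K * q) (∑-const n 1ℤ) (∑-const n (1ℤ * 1ℤ)) ⟩
        M * (+ n * 1ℤ * (+ n * 1ℤ)) + K * (+ n * (1ℤ * 1ℤ))  ∎
      simplify : ∀ K M n → let N = K + n * M in
        N * (n * (M + K * 1ℤ)) + - M * (M * (n * 1ℤ * (n * 1ℤ)) + K * (n * (1ℤ * 1ℤ))) ≡ n * (K * N)
      simplify = solve-∀

    n≤m : n ℕ.≤ m
    n≤m = ℤP.drop‿+≤+ (ℤP.*-cancelʳ-≤-pos (+ n) (+ m) L {{positive 0<L}} (begin
      + n * L          ≡⟨ ∑t≡nL ⟨
      ∑[ c < m ] t c   ≤⟨ sum-mono-≤ t≤L ⟩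
      ∑[ c < m ] L     ≡⟨ ∑-const m L ⟩
      + m * L          ∎))
      where open ℤP.≤-Reasoning

  indicator : ∀ {m} → Subset m → Fin m → ℤ
  indicator p c = if lookup p c then 1ℤ else 0ℤ

  ∣p∣≡∑indicator : ∀ {m} (p : Subset m) → + ∣ p ∣ ≡ sum (indicator p)
  ∣p∣≡∑indicator []          = refl
  ∣p∣≡∑indicator (true ∷ p)  = cong (_+_ 1ℤ) (∣p∣≡∑indicator p)
  ∣p∣≡∑indicator (false ∷ p) = trans (∣p∣≡∑indicator p) (sym (ℤP.+-identityˡ _))

  ⟨indicator,indicator⟩ : ∀ {m} (p q : Subset m) → ⟨ indicator p , indicator q ⟩ ≡ + ∣ p ∩ q ∣
  ⟨indicator,indicator⟩ p q = sym (trans (∣p∣≡∑indicator (p ∩ q)) (sum-cong-≗ pointwise))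
    where
    pointwise : ∀ c → indicator (p ∩ q) c ≡ indicator p c * indicator q c
    pointwise c rewrite lookup-zipWith _∧_ c p q with lookup p c | lookup q c
    ... | true  | b = sym (ℤP.*-identityˡ _)
    ... | false | b = refl

  fisher-inequality : ∀ {n m} (κ μ : ℕ) → 0 ℕ.< κ → (A : Fin n → Subset m) →
                      (∀ i → ∣ A i ∣ ≡ κ ℕ.+ μ) → (∀ {i j} → i ≢ j → ∣ A i ∩ A j ∣ ≡ μ) → n ℕ.≤ m
  fisher-inequality κ μ 0<κ A ∣A∣ ∣A∩A∣ = GramBound.n≤m κ μ 0<κ (indicator ∘ A) gram
    where
    gram : ∀ i j → ⟨ indicator (A i) , indicator (A j) ⟩ ≡ + μ + + κ * δ i j
    gram i j with i ≟ j
    ... | yes refl = begin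
      ⟨ indicator (A i) , indicator (A i) ⟩  ≡⟨ ⟨indicator,indicator⟩ (A i) (A i) ⟩
      + ∣ A i ∩ A i ∣                       ≡⟨ cong (+_ ∘ ∣_∣) (∩-idem (A i)) ⟩
      + ∣ A i ∣                             ≡⟨ cong +_ (∣A∣ i) ⟩
      + (κ ℕ.+ μ)                          ≡⟨ ℤP.pos-+ κ μ ⟩
      + κ + + μ                             ≡⟨ swap (+ κ) (+ μ) ⟩
      + μ + + κ * 1ℤ                        ≡⟨ cong (λ d → + μ + + κ * d) (δ-diag i) ⟨
      + μ + + κ * δ i i                     ∎
      where
      open ≡-Reasoning
      swap : ∀ K M → K + M ≡ M + K * 1ℤ
      swap = solve-∀
    ... | no i≢j = begin
      ⟨ indicator (A i) , indicator (A j) ⟩  ≡⟨ ⟨indicator,indicator⟩ (A i) (A j) ⟩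
      + ∣ A i ∩ A j ∣                       ≡⟨ cong +_ (∣A∩A∣ i≢j) ⟩
      + μ                                   ≡⟨ pad (+ κ) (+ μ) ⟩
      + μ + + κ * 0ℤ                        ≡⟨ cong (λ d → + μ + + κ * d) (δ-offdiag i≢j) ⟨
      + μ + + κ * δ i j                     ∎
      where
      open ≡-Reasoning
      pad : ∀ K M → M ≡ M + K * 0ℤ
      pad = solve-∀

open FisherInequality using (fisher-inequality)
open import Data.Nat.Base using (_+_; _*_; _≤_; _<_)
open import Data.Nat.Properties
  using (≤-trans; ≤-reflexive; ≤-antisym; <-≤-trans; m≤m+n; +-suc; +-comm; +-mono-≤; +-monoˡ-≤;
         +-cancelˡ-≤; +-cancelʳ-≤; +-cancelˡ-≡; m+[n∸m]≡n; module ≤-Reasoning)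
import Data.Nat.Properties as ℕP
open import Algebra.Properties.CommutativeSemigroup ℕP.+-commutativeSemigroup using (xy∙z≈xz∙y)
open import Data.Nat.Tactic.RingSolver using (solve-∀)

∣p++q∣≡∣p∣+∣q∣ : ∀ {m n} (p : Subset m) (q : Subset n) → ∣ p ++ q ∣ ≡ ∣ p ∣ + ∣ q ∣
∣p++q∣≡∣p∣+∣q∣ []          q = refl
∣p++q∣≡∣p∣+∣q∣ (true ∷ p)  q = cong suc (∣p++q∣≡∣p∣+∣q∣ p q)
∣p++q∣≡∣p∣+∣q∣ (false ∷ p) q = ∣p++q∣≡∣p∣+∣q∣ p q

∣p++q∩r++s∣≡∣p∩r∣+∣q∩s∣ : ∀ {m n} (p r : Subset m) (q s : Subset n) →
                          ∣ (p ++ q) ∩ (r ++ s) ∣ ≡ ∣ p ∩ r ∣ + ∣ q ∩ s ∣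
∣p++q∩r++s∣≡∣p∩r∣+∣q∩s∣ p r q s =
  trans (cong ∣_∣ (zipWith-++ _∧_ p q r s)) (∣p++q∣≡∣p∣+∣q∣ (p ∩ r) (q ∩ s))

∣p∪q∣+∣p∩q∣≡∣p∣+∣q∣ : ∀ {n} (p q : Subset n) → ∣ p ∪ q ∣ + ∣ p ∩ q ∣ ≡ ∣ p ∣ + ∣ q ∣
∣p∪q∣+∣p∩q∣≡∣p∣+∣q∣ []          []          = refl
∣p∪q∣+∣p∩q∣≡∣p∣+∣q∣ (true ∷ p)  (true ∷ q)  = cong suc (begin
  ∣ p ∪ q ∣ + suc ∣ p ∩ q ∣  ≡⟨ +-suc _ _ ⟩
  suc (∣ p ∪ q ∣ + ∣ p ∩ q ∣) ≡⟨ cong suc (∣p∪q∣+∣p∩q∣≡∣p∣+∣q∣ p q) ⟩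
  suc (∣ p ∣ + ∣ q ∣)         ≡⟨ +-suc _ _ ⟨
  ∣ p ∣ + suc ∣ q ∣           ∎)
  where open ≡-Reasoning
∣p∪q∣+∣p∩q∣≡∣p∣+∣q∣ (true ∷ p)  (false ∷ q) = cong suc (∣p∪q∣+∣p∩q∣≡∣p∣+∣q∣ p q)
∣p∪q∣+∣p∩q∣≡∣p∣+∣q∣ (false ∷ p) (true ∷ q)  =
  trans (cong suc (∣p∪q∣+∣p∩q∣≡∣p∣+∣q∣ p q)) (sym (+-suc _ _))
∣p∪q∣+∣p∩q∣≡∣p∣+∣q∣ (false ∷ p) (false ∷ q) = ∣p∪q∣+∣p∩q∣≡∣p∣+∣q∣ p q

∣p∪q∣≤∣p∣+∣q∣ : ∀ {n} (p q : Subset n) → ∣ p ∪ q ∣ ≤ ∣ p ∣ + ∣ q ∣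
∣p∪q∣≤∣p∣+∣q∣ p q = ≤-trans (m≤m+n _ _) (≤-reflexive (∣p∪q∣+∣p∩q∣≡∣p∣+∣q∣ p q))

∣p∩q∣+∣∁p∩q∣≡∣q∣ : ∀ {n} (p q : Subset n) → ∣ p ∩ q ∣ + ∣ ∁ p ∩ q ∣ ≡ ∣ q ∣
∣p∩q∣+∣∁p∩q∣≡∣q∣ []          []          = refl
∣p∩q∣+∣∁p∩q∣≡∣q∣ (true ∷ p)  (true ∷ q)  = cong suc (∣p∩q∣+∣∁p∩q∣≡∣q∣ p q)
∣p∩q∣+∣∁p∩q∣≡∣q∣ (false ∷ p) (true ∷ q)  = trans (+-suc _ _) (cong suc (∣p∩q∣+∣∁p∩q∣≡∣q∣ p q))
∣p∩q∣+∣∁p∩q∣≡∣q∣ (true ∷ p)  (false ∷ q) = ∣p∩q∣+∣∁p∩q∣≡∣q∣ p q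
∣p∩q∣+∣∁p∩q∣≡∣q∣ (false ∷ p) (false ∷ q) = ∣p∩q∣+∣∁p∩q∣≡∣q∣ p q

∣p∣+∣∁p∣≡n : ∀ {n} (p : Subset n) → ∣ p ∣ + ∣ ∁ p ∣ ≡ n
∣p∣+∣∁p∣≡n p = trans (cong (∣ p ∣ +_) (∣∁p∣≡n∸∣p∣ p)) (m+[n∸m]≡n (∣p∣≤n p))

⊤⊆p⇒n≤∣p∣ : ∀ {n} {p : Subset n} → ⊤ ⊆ p → n ≤ ∣ p ∣
⊤⊆p⇒n≤∣p∣ {n} {p} ⊤⊆p = subst (_≤ ∣ p ∣) (∣⊤∣≡n n) (p⊆q⇒∣p∣≤∣q∣ ⊤⊆p)

Dominating : (G : Graph) {m : ℕ} → (Vtx G → Subset m) → Set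
Dominating G φ = ∀ v c → Σ (Vtx G) λ u → InClosedNbhd G u v × c ∈ φ u

∈-++⁺ˡ : ∀ {m n} {p : Subset m} {q : Subset n} {c} → c ∈ p → (c ↑ˡ n) ∈ p ++ q
∈-++⁺ˡ here        = here
∈-++⁺ˡ (there c∈p) = there (∈-++⁺ˡ c∈p)

∈-++⁺ʳ : ∀ {m n} (p : Subset m) {q : Subset n} {c} → c ∈ q → (m ↑ʳ c) ∈ p ++ q
∈-++⁺ʳ []      c∈q = c∈q
∈-++⁺ʳ (_ ∷ p) c∈q = there (∈-++⁺ʳ p c∈q)

Dominating-++ : ∀ {G m n} {φ : Vtx G → Subset m} {ψ : Vtx G → Subset n} →
                Dominating G φ → Dominating G ψ → Dominating G (λ v → φ v ++ ψ v)
Dominating-++ {m = m} {n} {φ} φ-dom ψ-dom v c with splitAt m c | join-splitAt m n c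
... | inj₁ d | refl = let u , u∈N[v] , d∈φu = φ-dom v d in u , u∈N[v] , ∈-++⁺ˡ d∈φu
... | inj₂ d | refl = let u , u∈N[v] , d∈ψu = ψ-dom v d in u , u∈N[v] , ∈-++⁺ʳ (φ u) d∈ψu

module Gadget {n p q : ℕ} (D : DomColouring (G36 n) p q) {i j : Fin n} .(i<j : i Fin.< j) where

  open DomColouring D

  private
    x y z : V n
    x = sub i j i<j tx
    y = sub i j i<j ty
    z = sub i j i<j tz

  long-path-cover : ⊤ ⊆ (φ y ∪ φ z) ∪ (φ (orig i) ∩ φ (orig j))
  long-path-cover {c} _ with cover y c | cover z c
  ... | _ , inj₁ refl , c∈φy | _ = x∈p∪q⁺ (inj₁ (x∈p∪q⁺ (inj₁ c∈φy)))
  ... | _ , inj₂ (inj₁ (e-yz _)) , c∈φz | _ = x∈p∪q⁺ (inj₁ (x∈p∪q⁺ (inj₂ c∈φz)))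
  ... | _ , inj₂ (inj₂ (e-iy _)) , _ | _ , inj₁ refl , c∈φz =
    x∈p∪q⁺ (inj₁ (x∈p∪q⁺ (inj₂ c∈φz)))
  ... | _ , inj₂ (inj₂ (e-iy _)) , _ | _ , inj₂ (inj₂ (e-yz _)) , c∈φy =
    x∈p∪q⁺ (inj₁ (x∈p∪q⁺ (inj₁ c∈φy)))
  ... | _ , inj₂ (inj₂ (e-iy _)) , c∈φi | _ , inj₂ (inj₁ (e-zj _)) , c∈φj =
    x∈p∪q⁺ (inj₂ (x∈p∩q⁺ (c∈φi , c∈φj)))

  short-path-cover : ⊤ ⊆ (φ (orig i) ∪ φ (orig j)) ∪ φ x
  short-path-cover {c} _ with cover x c
  ... | _ , inj₁ refl , c∈φx = x∈p∪q⁺ (inj₂ c∈φx)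
  ... | _ , inj₂ (inj₂ (e-ix _)) , c∈φi = x∈p∪q⁺ (inj₁ (x∈p∪q⁺ (inj₁ c∈φi)))
  ... | _ , inj₂ (inj₁ (e-xj _)) , c∈φj = x∈p∪q⁺ (inj₁ (x∈p∪q⁺ (inj₂ c∈φj)))

  long-path-count : p ≤ q + q + ∣ φ (orig i) ∩ φ (orig j) ∣
  long-path-count = begin
    p                                                ≤⟨ ⊤⊆p⇒n≤∣p∣ long-path-cover ⟩
    ∣ (φ y ∪ φ z) ∪ (φ (orig i) ∩ φ (orig j)) ∣      ≤⟨ ∣p∪q∣≤∣p∣+∣q∣ (φ y ∪ φ z) _ ⟩
    ∣ φ y ∪ φ z ∣ + ∣ φ (orig i) ∩ φ (orig j) ∣      ≤⟨ +-monoˡ-≤ _ (∣p∪q∣≤∣p∣+∣q∣ (φ y) (φ z)) ⟩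
    ∣ φ y ∣ + ∣ φ z ∣ + ∣ φ (orig i) ∩ φ (orig j) ∣  ≡⟨ cong₂ (λ a b → a + b + _) (size y) (size z) ⟩
    q + q + ∣ φ (orig i) ∩ φ (orig j) ∣              ∎
    where open ≤-Reasoning

  short-path-count : p + ∣ φ (orig i) ∩ φ (orig j) ∣ ≤ q + q + q
  short-path-count = begin
    p + ∣ φi ∩ φj ∣                      ≤⟨ +-monoˡ-≤ _ (⊤⊆p⇒n≤∣p∣ short-path-cover) ⟩
    ∣ (φi ∪ φj) ∪ φ x ∣ + ∣ φi ∩ φj ∣    ≤⟨ +-monoˡ-≤ _ (∣p∪q∣≤∣p∣+∣q∣ (φi ∪ φj) (φ x)) ⟩
    ∣ φi ∪ φj ∣ + ∣ φ x ∣ + ∣ φi ∩ φj ∣  ≡⟨ xy∙z≈xz∙y (∣ φi ∪ φj ∣) (∣ φ x ∣) (∣ φi ∩ φj ∣) ⟩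
    ∣ φi ∪ φj ∣ + ∣ φi ∩ φj ∣ + ∣ φ x ∣  ≡⟨ cong (_+ ∣ φ x ∣) (∣p∪q∣+∣p∩q∣≡∣p∣+∣q∣ φi φj) ⟩
    ∣ φi ∣ + ∣ φj ∣ + ∣ φ x ∣            ≡⟨ cong₂ (λ a b → a + b + ∣ φ x ∣) (size (orig i)) (size (orig j)) ⟩
    q + q + ∣ φ x ∣                      ≡⟨ cong (q + q +_) (size x) ⟩
    q + q + q                            ∎
    where
    open ≤-Reasoning
    φi φj : Subset p
    φi = φ (orig i)
    φj = φ (orig j)

p≤2q+I∧p+I≤3q⇒2p≤5q : ∀ {p q I} → p ≤ q + q + I → p + I ≤ q + q + q → p * 2 ≤ 5 * q
p≤2q+I∧p+I≤3q⇒2p≤5q {p} {q} {I} long short = +-cancelˡ-≤ I (p * 2) (5 * q) (begin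
  I + p * 2                  ≡⟨ regroup p I ⟩
  (p + I) + p                ≤⟨ +-mono-≤ short long ⟩
  (q + q + q) + (q + q + I)  ≡⟨ regroup′ q I ⟩
  I + 5 * q                  ∎)
  where
  open ≤-Reasoning
  regroup : ∀ p I → I + p * 2 ≡ (p + I) + p
  regroup = solve-∀
  regroup′ : ∀ q I → (q + q + q) + (q + q + I) ≡ I + 5 * q
  regroup′ = solve-∀

5k≤4k+I∧5k+I≤6k⇒I≡k : ∀ {k I} → 5 * k ≤ 2 * k + 2 * k + I → 5 * k + I ≤ 2 * k + 2 * k + 2 * k → I ≡ k
5k≤4k+I∧5k+I≤6k⇒I≡k {k} {I} long short = ≤-antisym I≤k k≤I
  where
  open ≤-Reasoning
  split5 : ∀ k → 2 * k + 2 * k + k ≡ 5 * k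
  split5 = solve-∀
  split6 : ∀ k → 2 * k + 2 * k + 2 * k ≡ k + 5 * k
  split6 = solve-∀
  k≤I : k ≤ I
  k≤I = +-cancelˡ-≤ (2 * k + 2 * k) k I (begin
    2 * k + 2 * k + k      ≡⟨ split5 k ⟩
    5 * k                  ≤⟨ long ⟩
    2 * k + 2 * k + I      ∎)
  I≤k : I ≤ k
  I≤k = +-cancelʳ-≤ (5 * k) I k (begin
    I + 5 * k              ≡⟨ +-comm I (5 * k) ⟩
    5 * k + I              ≤⟨ short ⟩
    2 * k + 2 * k + 2 * k  ≡⟨ split6 k ⟩
    k + 5 * k              ∎)

fdom≤5/2 : ∀ {n p q} → 2 ≤ n → DomColouring (G36 n) p q → p * 2 ≤ 5 * q
fdom≤5/2 {q = q} (s≤s (s≤s z≤n)) D = p≤2q+I∧p+I≤3q⇒2p≤5q {q = q} long-path-count short-path-count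
  where open Gadget D {zero} {suc zero} z<s

module _ {n k : ℕ} (D : DomColouring (G36 n) (5 * k) (2 * k)) where

  open DomColouring D

  ∣φi∩φj∣≡k : ∀ {i j} → i ≢ j → ∣ φ (orig i) ∩ φ (orig j) ∣ ≡ k
  ∣φi∩φj∣≡k {i} {j} i≢j with <-cmp i j
  ... | tri< i<j _ _ = 5k≤4k+I∧5k+I≤6k⇒I≡k long-path-count short-path-count
    where open Gadget D i<j
  ... | tri≈ _ i≡j _ = ⊥-elim (i≢j i≡j)
  ... | tri> _ _ j<i =
    trans (cong ∣_∣ (∩-comm (φ (orig i)) _)) (5k≤4k+I∧5k+I≤6k⇒I≡k long-path-count short-path-count)
    where open Gadget D j<i

  n≤5k : 1 ≤ k → n ≤ 5 * k
  n≤5k 1≤k = fisher-inequality k k 1≤k (φ ∘ orig) ∣φi∣≡k+k ∣φi∩φj∣≡k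
    where
    ∣φi∣≡k+k : ∀ i → ∣ φ (orig i) ∣ ≡ k + k
    ∣φi∣≡k+k i = trans (size (orig i)) (cong (k +_) (ℕP.+-identityʳ k))

i<j⇒i≢j : ∀ {n} {i j : Fin n} → .(i Fin.< j) → i ≢ j
i<j⇒i≢j {i = i} {j} i<j = FinP.<⇒≢ (recompute (i FinP.<? j) i<j)

-- The sizes are sums of k so that they agree definitionally with those of the half-cubes below.
module BalancedConstruction {n k : ℕ} (A : Fin (suc (suc n)) → Subset ((k + k) + (k + k)))
                            (∣A∣ : ∀ i → ∣ A i ∣ ≡ k + k)
                            (∣A∩A∣ : ∀ {i j} → i ≢ j → ∣ A i ∩ A j ∣ ≡ k) where

  ∣∁A∣ : ∀ i → ∣ ∁ (A i) ∣ ≡ k + k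
  ∣∁A∣ i = +-cancelˡ-≡ (k + k) _ _ (trans (cong (_+ ∣ ∁ (A i) ∣) (sym (∣A∣ i))) (∣p∣+∣∁p∣≡n (A i)))

  ∣∁A∩A∣ : ∀ {i j} → i ≢ j → ∣ ∁ (A i) ∩ A j ∣ ≡ k
  ∣∁A∩A∣ {i} {j} i≢j = +-cancelˡ-≡ k _ _ (begin
    k + ∣ ∁ (A i) ∩ A j ∣          ≡⟨ cong (_+ ∣ ∁ (A i) ∩ A j ∣) (∣A∩A∣ i≢j) ⟨
    ∣ A i ∩ A j ∣ + ∣ ∁ (A i) ∩ A j ∣ ≡⟨ ∣p∩q∣+∣∁p∩q∣≡∣q∣ (A i) (A j) ⟩
    ∣ A j ∣                         ≡⟨ ∣A∣ j ⟩
    k + k                           ∎)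
    where open ≡-Reasoning

  ∣∁A∩∁A∣ : ∀ {i j} → i ≢ j → ∣ ∁ (A i) ∩ ∁ (A j) ∣ ≡ k
  ∣∁A∩∁A∣ {i} {j} i≢j = +-cancelˡ-≡ k _ _ (begin
    k + ∣ ∁Aᵢ ∩ ∁Aⱼ ∣               ≡⟨ cong (_+ ∣ ∁Aᵢ ∩ ∁Aⱼ ∣) (∣∁A∩A∣ (i≢j ∘ sym)) ⟨
    ∣ ∁Aⱼ ∩ A i ∣ + ∣ ∁Aᵢ ∩ ∁Aⱼ ∣   ≡⟨ cong (λ s → ∣ s ∣ + ∣ ∁Aᵢ ∩ ∁Aⱼ ∣) (∩-comm ∁Aⱼ (A i)) ⟩
    ∣ A i ∩ ∁Aⱼ ∣ + ∣ ∁Aᵢ ∩ ∁Aⱼ ∣   ≡⟨ ∣p∩q∣+∣∁p∩q∣≡∣q∣ (A i) ∁Aⱼ ⟩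
    ∣ ∁Aⱼ ∣                         ≡⟨ ∣∁A∣ j ⟩
    k + k                           ∎)
    where
    open ≡-Reasoning
    ∁Aᵢ ∁Aⱼ : Subset ((k + k) + (k + k))
    ∁Aᵢ = ∁ (A i)
    ∁Aⱼ = ∁ (A j)

  spare : V (suc (suc n)) → Subset k
  spare (sub _ _ _ tx) = ⊤
  spare (sub _ _ _ ty) = ⊤
  spare _              = ⊥

  cells : V (suc (suc n)) → Subset ((k + k) + (k + k))
  cells (orig i)       = A i
  cells (sub i j _ tx) = ∁ (A i) ∩ ∁ (A j)
  cells (sub i j _ ty) = ∁ (A i) ∩ A j
  cells (sub i j _ tz) = ∁ (A j)

  spare-dominating : Dominating (G36 (suc (suc n))) spare
  spare-dominating (orig zero)      _ = sub zero (suc zero) z<s tx , inj₂ (inj₁ (e-ix _)) , ∈⊤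
  spare-dominating (orig (suc i))   _ = sub zero (suc i) z<s tx , inj₂ (inj₂ (e-xj _)) , ∈⊤
  spare-dominating (sub i j i<j tx) _ = sub i j i<j tx , inj₁ refl , ∈⊤
  spare-dominating (sub i j i<j ty) _ = sub i j i<j ty , inj₁ refl , ∈⊤
  spare-dominating (sub i j i<j tz) _ = sub i j i<j ty , inj₂ (inj₂ (e-yz _)) , ∈⊤

  cells-dominating : Dominating (G36 (suc (suc n))) cells
  cells-dominating (orig i) c with c ∈? A i
  ... | yes c∈Aᵢ = orig i , inj₁ refl , c∈Aᵢ
  cells-dominating (orig zero) c | no c∉A₀ with c ∈? A (suc zero)
  ... | yes c∈A₁ =
    sub zero (suc zero) z<s ty , inj₂ (inj₁ (e-iy _)) , x∈p∩q⁺ (x∉p⇒x∈∁p c∉A₀ , c∈A₁)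
  ... | no c∉A₁ =
    sub zero (suc zero) z<s tx , inj₂ (inj₁ (e-ix _)) , x∈p∩q⁺ (x∉p⇒x∈∁p c∉A₀ , x∉p⇒x∈∁p c∉A₁)
  cells-dominating (orig (suc i)) c | no c∉Aᵢ =
    sub zero (suc i) z<s tz , inj₂ (inj₂ (e-zj _)) , x∉p⇒x∈∁p c∉Aᵢ
  cells-dominating (sub i j i<j tx) c with c ∈? A i | c ∈? A j
  ... | yes c∈Aᵢ | _        = orig i , inj₂ (inj₂ (e-ix i<j)) , c∈Aᵢ
  ... | no _     | yes c∈Aⱼ = orig j , inj₂ (inj₁ (e-xj i<j)) , c∈Aⱼ
  ... | no c∉Aᵢ  | no c∉Aⱼ  = sub i j i<j tx , inj₁ refl , x∈p∩q⁺ (x∉p⇒x∈∁p c∉Aᵢ , x∉p⇒x∈∁p c∉Aⱼ)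
  cells-dominating (sub i j i<j ty) c with c ∈? A i | c ∈? A j
  ... | yes c∈Aᵢ | _        = orig i , inj₂ (inj₂ (e-iy i<j)) , c∈Aᵢ
  ... | no c∉Aᵢ  | yes c∈Aⱼ = sub i j i<j ty , inj₁ refl , x∈p∩q⁺ (x∉p⇒x∈∁p c∉Aᵢ , c∈Aⱼ)
  ... | no _     | no c∉Aⱼ  = sub i j i<j tz , inj₂ (inj₁ (e-yz i<j)) , x∉p⇒x∈∁p c∉Aⱼ
  cells-dominating (sub i j i<j tz) c with c ∈? A j
  ... | yes c∈Aⱼ = orig j , inj₂ (inj₁ (e-zj i<j)) , c∈Aⱼ
  ... | no c∉Aⱼ  = sub i j i<j tz , inj₁ refl , x∉p⇒x∈∁p c∉Aⱼ

  ∣spare∣+∣cells∣ : ∀ v → ∣ spare v ∣ + ∣ cells v ∣ ≡ k + k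
  ∣spare∣+∣cells∣ (orig i)         = cong₂ _+_ (∣⊥∣≡0 k) (∣A∣ i)
  ∣spare∣+∣cells∣ (sub i j i<j tx) = cong₂ _+_ (∣⊤∣≡n k) (∣∁A∩∁A∣ (i<j⇒i≢j i<j))
  ∣spare∣+∣cells∣ (sub i j i<j ty) = cong₂ _+_ (∣⊤∣≡n k) (∣∁A∩A∣ (i<j⇒i≢j i<j))
  ∣spare∣+∣cells∣ (sub i j i<j tz) = cong₂ _+_ (∣⊥∣≡0 k) (∣∁A∣ j)

  colouring : DomColouring (G36 (suc (suc n))) (k + ((k + k) + (k + k))) (k + k)
  colouring = record
    { φ     = λ v → spare v ++ cells v
    ; size  = λ v → trans (∣p++q∣≡∣p∣+∣q∣ (spare v) (cells v)) (∣spare∣+∣cells∣ v)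
    ; cover = Dominating-++ spare-dominating cells-dominating
    }

2^_ : ℕ → ℕ
2^ zero  = 1
2^ suc n = 2^ n + 2^ n

half-cube : ∀ n → Fin n → Subset (2^ n)
half-cube (suc n) zero    = ⊥ {2^ n} ++ ⊤
half-cube (suc n) (suc i) = half-cube n i ++ half-cube n i

∣half-cube∣ : ∀ n (i : Fin (suc n)) → ∣ half-cube (suc n) i ∣ ≡ 2^ n
∣half-cube∣ n       zero    =
  trans (∣p++q∣≡∣p∣+∣q∣ (⊥ {2^ n}) ⊤) (cong₂ _+_ (∣⊥∣≡0 (2^ n)) (∣⊤∣≡n (2^ n)))
∣half-cube∣ (suc n) (suc i) =
  trans (∣p++q∣≡∣p∣+∣q∣ (half-cube (suc n) i) _) (cong₂ _+_ (∣half-cube∣ n i) (∣half-cube∣ n i))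

∣half-cube∩half-cube∣ : ∀ n {i j : Fin (suc (suc n))} → i ≢ j →
                        ∣ half-cube (suc (suc n)) i ∩ half-cube (suc (suc n)) j ∣ ≡ 2^ n
∣half-cube∩half-cube∣ n       {zero}  {zero}  i≢j = ⊥-elim (i≢j refl)
∣half-cube∩half-cube∣ n       {zero}  {suc j} _   = begin
  ∣ (∅ ++ ⊤) ∩ (Hⱼ ++ Hⱼ) ∣     ≡⟨ ∣p++q∩r++s∣≡∣p∩r∣+∣q∩s∣ ∅ Hⱼ ⊤ Hⱼ ⟩
  ∣ ∅ ∩ Hⱼ ∣ + ∣ ⊤ ∩ Hⱼ ∣       ≡⟨ cong₂ (λ s t → ∣ s ∣ + ∣ t ∣) (∩-zeroˡ Hⱼ) (∩-identityˡ Hⱼ) ⟩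
  ∣ ∅ ∣ + ∣ Hⱼ ∣                ≡⟨ cong₂ _+_ (∣⊥∣≡0 (2^ suc n)) (∣half-cube∣ n j) ⟩
  2^ n                         ∎
  where
  open ≡-Reasoning
  ∅ Hⱼ : Subset (2^ suc n)
  ∅  = ⊥
  Hⱼ = half-cube (suc n) j
∣half-cube∩half-cube∣ n       {suc i} {zero}  i≢j =
  trans (cong ∣_∣ (∩-comm (half-cube _ (suc i)) _)) (∣half-cube∩half-cube∣ n (i≢j ∘ sym))
∣half-cube∩half-cube∣ zero    {suc zero} {suc zero} i≢j = ⊥-elim (i≢j refl)
∣half-cube∩half-cube∣ (suc n) {suc i} {suc j} i≢j =
  trans (∣p++q∩r++s∣≡∣p∩r∣+∣q∩s∣ (half-cube _ i) _ (half-cube _ i) _)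
        (cong₂ _+_ (∣half-cube∩half-cube∣ n (i≢j ∘ cong suc)) (∣half-cube∩half-cube∣ n (i≢j ∘ cong suc)))

2^n>0 : ∀ n → 0 < 2^ n
2^n>0 zero    = z<s
2^n>0 (suc n) = <-≤-trans (2^n>0 n) (m≤m+n _ _)

fdom≥5/2 : ∀ m → Σ ℕ λ p → Σ ℕ λ q → (1 ≤ q) × DomColouring (G36 (suc (suc m))) p q × (p * 2 ≡ 5 * q)
fdom≥5/2 m =
  2^ m + 2^ suc (suc m) , 2^ m + 2^ m , ≤-trans (2^n>0 m) (m≤m+n _ _) , colouring , ratio (2^ m)
  where
  open BalancedConstruction (half-cube (suc (suc m))) (∣half-cube∣ (suc m)) (∣half-cube∩half-cube∣ m)
  ratio : ∀ k → (k + ((k + k) + (k + k))) * 2 ≡ 5 * (k + k)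
  ratio = solve-∀

proposition36 : (n : ℕ) → 2 ≤ n →
    FdomEq (G36 n) 5 2
    × (∀ k → 1 ≤ k → DomColouring (G36 n) (5 * k) (2 * k) → n ≤ 5 * k)
proposition36 (suc (suc m)) 2≤n@(s≤s (s≤s z≤n)) =
  (fdom≥5/2 m , λ _ _ _ → fdom≤5/2 2≤n) , λ _ 1≤k D → n≤5k D 1≤k
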